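{- Consider the following data: a category $\mathscr{C}$ (either the category of Boolean algebras or of distributive lattices) with a free–forgetful adjunction $\mathsf{F}\dashv\mathsf{U}$, $\mathsf{F}:\mathbf{Set}\to\mathscr{C}$; a finitary endofunctor $L:\mathscr{C}\to\mathscr{C}$ with free–forgetful adjunction $F_L\dashv U_L$ between $\mathscr{C}$ and the category of $L$-algebras; a category $\mathscr{D}$ with endofunctor $T:\mathscr{D}\to\mathscr{D}$; a dual adjunction $G\dashv P$ with $G:\mathscr{C}\to\mathscr{D}^{op}$, $P:\mathscr{D}^{op}\to\mathscr{C}$; and a natural transformation $\delta:LP\to PT$. Let $\mathrm{At}$ be a set, and let $\Phi\subseteq \mathsf{U}U_LF_L\mathsf{F}\mathrm{At}$ be a set of modal formulas. Define $e_1,e_2:\Phi\rightrightarrows \mathsf{U}U_LF_L\mathsf{F}\mathrm{At}$ by $e_1(\varphi)=\varphi$ and $e_2(\varphi)=\top$, let $\hat e_1,\hat e_2:F_L\mathsf{F}\Phi\rightrightarrows F_L\mathsf{F}\mathrm{At}$ be their adjoint transposes (as $L$-algebra morphisms), and let $q:F_L\mathsf{F}\mathrm{At}\to Q$ be their coequalizer in the category of $L$-algebras. Then for every $T$-coalgebra $(X,\gamma)$, we have $(X,\gamma)\models\Phi$ if and only if $q\perp\widehat{P}(X,\gamma)$.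
   Context: For a $T$-coalgebra $\gamma:X\to TX$, $\widehat{P}(X,\gamma)$ is the $L$-algebra $P\gamma\circ\delta_X: LPX\to PTX\to PX$ (here $P\gamma$ is viewed as a $\mathscr{C}$-morphism $PTX\to PX$). A valuation is a map $v:\mathrm{At}\to\mathsf{U}PX$; it extends to a $\mathscr{C}$-morphism $\hat v:\mathsf{F}\mathrm{At}\to PX = U_L\widehat{P}(X,\gamma)$, and hence to a unique $L$-algebra morphism $[\![-]\!]_v:F_L\mathsf{F}\mathrm{At}\to\widehat{P}(X,\gamma)$. A formula $\varphi\in F_L\mathsf{F}\mathrm{At}$ is valid in $(X,\gamma)$ if $[\![\varphi]\!]_v$ equals the top element of $PX$ (i.e. is satisfied at every state) for every valuation $v$; $(X,\gamma)\models\Phi$ means every $\varphi\in\Phi$ is valid in $(X,\gamma)$. For a morphism $q:F_L\mathsf{F}\mathrm{At}\to Q$ of $L$-algebras and an $L$-algebra $A$, $q\perp A$ (orthogonality) means every $L$-algebra morphism $f:F_L\mathsf{F}\mathrm{At}\to A$ factors uniquely as $f=g\circ q$ for an $L$-algebra morphism $g:Q\to A$. -}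

module Defs where

open import Level using (Level; _⊔_; 0ℓ) renaming (suc to lsuc)
open import Data.Product using (Σ; Σ-syntax; _×_; _,_; proj₁; proj₂)
open import Data.Unit using () renaming (⊤ to Unit)
open import Relation.Binary using (Rel; IsEquivalence; Setoid)
open import Relation.Binary.PropositionalEquality as ≡ using (_≡_)
open import Function.Bundles using (Func)
open import Algebra.Lattice.Bundles using (BooleanAlgebra)
open import Algebra.Lattice.Structures using (IsDistributiveLattice)
import Relation.Binary.Reasoning.Setoid as SetoidR

record Category (o m e : Level) : Set (lsuc (o ⊔ m ⊔ e)) where
  infix  4 _≈_
  infixr 9 _∘_
  field
    Obj       : Set o
    _⇒_       : Obj → Obj → Set m
    _≈_       : ∀ {A B} → Rel (A ⇒ B) e
    id        : ∀ {A} → A ⇒ A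
    _∘_       : ∀ {A B C} → B ⇒ C → A ⇒ B → A ⇒ C
    equiv     : ∀ {A B} → IsEquivalence (_≈_ {A} {B})
    identityˡ : ∀ {A B} {f : A ⇒ B} → id ∘ f ≈ f
    identityʳ : ∀ {A B} {f : A ⇒ B} → f ∘ id ≈ f
    assoc     : ∀ {A B C D} {f : A ⇒ B} {g : B ⇒ C} {h : C ⇒ D} →
                (h ∘ g) ∘ f ≈ h ∘ (g ∘ f)
    ∘-resp-≈  : ∀ {A B C} {f h : B ⇒ C} {g i : A ⇒ B} →
                f ≈ h → g ≈ i → f ∘ g ≈ h ∘ i

  hom-setoid : Obj → Obj → Setoid m e
  hom-setoid A B = record { Carrier = A ⇒ B ; _≈_ = _≈_ ; isEquivalence = equiv }

  module Equiv {A B : Obj} = IsEquivalence (equiv {A} {B})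

open Category

_op : ∀ {o m e} → Category o m e → Category o m e
𝒜 op = record
  { Obj = Obj 𝒜
  ; _⇒_ = λ A B → _⇒_ 𝒜 B A
  ; _≈_ = _≈_ 𝒜
  ; id = id 𝒜
  ; _∘_ = λ f g → _∘_ 𝒜 g f
  ; equiv = equiv 𝒜
  ; identityˡ = identityʳ 𝒜
  ; identityʳ = identityˡ 𝒜
  ; assoc = IsEquivalence.sym (equiv 𝒜) (assoc 𝒜)
  ; ∘-resp-≈ = λ p q → ∘-resp-≈ 𝒜 q p
  }

record Functor {o₁ m₁ e₁ o₂ m₂ e₂}
               (𝒜 : Category o₁ m₁ e₁) (ℬ : Category o₂ m₂ e₂)
               : Set (o₁ ⊔ m₁ ⊔ e₁ ⊔ o₂ ⊔ m₂ ⊔ e₂) where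
  field
    F₀           : Obj 𝒜 → Obj ℬ
    F₁           : ∀ {A B} → _⇒_ 𝒜 A B → _⇒_ ℬ (F₀ A) (F₀ B)
    identity     : ∀ {A} → _≈_ ℬ (F₁ (id 𝒜 {A})) (id ℬ)
    homomorphism : ∀ {A B C} {f : _⇒_ 𝒜 A B} {g : _⇒_ 𝒜 B C} →
                   _≈_ ℬ (F₁ (_∘_ 𝒜 g f)) (_∘_ ℬ (F₁ g) (F₁ f))
    F-resp-≈     : ∀ {A B} {f g : _⇒_ 𝒜 A B} →
                   _≈_ 𝒜 f g → _≈_ ℬ (F₁ f) (F₁ g)

open Functor

idF : ∀ {o m e} {𝒜 : Category o m e} → Functor 𝒜 𝒜
idF {𝒜 = 𝒜} = record
  { F₀ = λ A → A ; F₁ = λ f → f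
  ; identity = Equiv.refl 𝒜 ; homomorphism = Equiv.refl 𝒜
  ; F-resp-≈ = λ p → p }

infixr 9 _∘F_
_∘F_ : ∀ {o₁ m₁ e₁ o₂ m₂ e₂ o₃ m₃ e₃}
         {𝒜 : Category o₁ m₁ e₁} {ℬ : Category o₂ m₂ e₂} {𝒞 : Category o₃ m₃ e₃} →
       Functor ℬ 𝒞 → Functor 𝒜 ℬ → Functor 𝒜 𝒞
_∘F_ {𝒞 = 𝒞} G F = record
  { F₀ = λ A → F₀ G (F₀ F A)
  ; F₁ = λ f → F₁ G (F₁ F f)
  ; identity = IsEquivalence.trans (equiv 𝒞) (F-resp-≈ G (identity F)) (identity G)
  ; homomorphism = IsEquivalence.trans (equiv 𝒞) (F-resp-≈ G (homomorphism F)) (homomorphism G)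
  ; F-resp-≈ = λ p → F-resp-≈ G (F-resp-≈ F p)
  }

opF : ∀ {o₁ m₁ e₁ o₂ m₂ e₂} {𝒜 : Category o₁ m₁ e₁} {ℬ : Category o₂ m₂ e₂} →
      Functor 𝒜 ℬ → Functor (𝒜 op) (ℬ op)
opF F = record
  { F₀ = F₀ F ; F₁ = F₁ F ; identity = identity F
  ; homomorphism = homomorphism F ; F-resp-≈ = F-resp-≈ F }

record NatTrans {o₁ m₁ e₁ o₂ m₂ e₂}
                {𝒜 : Category o₁ m₁ e₁} {ℬ : Category o₂ m₂ e₂}
                (F G : Functor 𝒜 ℬ) : Set (o₁ ⊔ m₁ ⊔ e₁ ⊔ o₂ ⊔ m₂ ⊔ e₂) where
  field
    η       : ∀ A → _⇒_ ℬ (F₀ F A) (F₀ G A)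
    commute : ∀ {A B} (f : _⇒_ 𝒜 A B) →
              _≈_ ℬ (_∘_ ℬ (η B) (F₁ F f)) (_∘_ ℬ (F₁ G f) (η A))

record Adjunction {o₁ m₁ e₁ o₂ m₂ e₂}
                  {𝒜 : Category o₁ m₁ e₁} {ℬ : Category o₂ m₂ e₂}
                  (Lf : Functor 𝒜 ℬ) (Rf : Functor ℬ 𝒜)
                  : Set (o₁ ⊔ m₁ ⊔ e₁ ⊔ o₂ ⊔ m₂ ⊔ e₂) where
  field
    unit   : NatTrans idF (Rf ∘F Lf)
    counit : NatTrans (Lf ∘F Rf) idF
    zig    : ∀ {A} → _≈_ ℬ (_∘_ ℬ (NatTrans.η counit (F₀ Lf A)) (F₁ Lf (NatTrans.η unit A))) (id ℬ)
    zag    : ∀ {B} → _≈_ 𝒜 (_∘_ 𝒜 (F₁ Rf (NatTrans.η counit B)) (NatTrans.η unit (F₀ Rf B))) (id 𝒜)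

-- A universal arrow from the object b to the functor U
-- (a free object over b; a left adjoint to U is a choice of these for all b)
record UniversalArrow {o₁ m₁ e₁ o₂ m₂ e₂}
                      {𝒜 : Category o₁ m₁ e₁} {ℬ : Category o₂ m₂ e₂}
                      (U : Functor 𝒜 ℬ) (b : Obj ℬ)
                      : Set (o₁ ⊔ m₁ ⊔ e₁ ⊔ o₂ ⊔ m₂ ⊔ e₂) where
  field
    obj        : Obj 𝒜
    η          : _⇒_ ℬ b (F₀ U obj)
    ext        : ∀ {a} → _⇒_ ℬ b (F₀ U a) → _⇒_ 𝒜 obj a
    ext-β      : ∀ {a} (f : _⇒_ ℬ b (F₀ U a)) → _≈_ ℬ (_∘_ ℬ (F₁ U (ext f)) η) f
    ext-unique : ∀ {a} (f : _⇒_ ℬ b (F₀ U a)) (g : _⇒_ 𝒜 obj a) →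
                 _≈_ ℬ (_∘_ ℬ (F₁ U g) η) f → _≈_ 𝒜 g (ext f)

record IsCoequalizer {o m e} (𝒜 : Category o m e) {A B Q : Obj 𝒜}
                     (f g : _⇒_ 𝒜 A B) (q : _⇒_ 𝒜 B Q) : Set (o ⊔ m ⊔ e) where
  field
    equality : _≈_ 𝒜 (_∘_ 𝒜 q f) (_∘_ 𝒜 q g)
    coeq     : ∀ {Z} (h : _⇒_ 𝒜 B Z) → _≈_ 𝒜 (_∘_ 𝒜 h f) (_∘_ 𝒜 h g) →
               Σ[ k ∈ _⇒_ 𝒜 Q Z ] (_≈_ 𝒜 (_∘_ 𝒜 k q) h
                 × (∀ (k' : _⇒_ 𝒜 Q Z) → _≈_ 𝒜 (_∘_ 𝒜 k' q) h → _≈_ 𝒜 k' k))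

Orthogonal : ∀ {o m e} (𝒜 : Category o m e) {B Q : Obj 𝒜} →
             _⇒_ 𝒜 B Q → Obj 𝒜 → Set (m ⊔ e)
Orthogonal 𝒜 {B} {Q} q A =
  ∀ (f : _⇒_ 𝒜 B A) →
    Σ[ g ∈ _⇒_ 𝒜 Q A ] (_≈_ 𝒜 (_∘_ 𝒜 g q) f
      × (∀ (g' : _⇒_ 𝒜 Q A) → _≈_ 𝒜 (_∘_ 𝒜 g' q) f → _≈_ 𝒜 g' g))

record DirectedDiagram {o m e} (𝒜 : Category o m e) : Set (lsuc 0ℓ ⊔ o ⊔ m ⊔ e) where
  field
    Idx       : Set
    _≤_       : Idx → Idx → Set
    ≤-refl    : ∀ {i} → i ≤ i
    ≤-trans   : ∀ {i j k} → i ≤ j → j ≤ k → i ≤ k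
    inhabited : Idx
    upper     : ∀ i j → Σ[ k ∈ Idx ] (i ≤ k × j ≤ k)
    D₀        : Idx → Obj 𝒜
    D₁        : ∀ {i j} → i ≤ j → _⇒_ 𝒜 (D₀ i) (D₀ j)
    D-irr     : ∀ {i j} (p q : i ≤ j) → _≈_ 𝒜 (D₁ p) (D₁ q)
    D-id      : ∀ {i} → _≈_ 𝒜 (D₁ (≤-refl {i})) (id 𝒜)
    D-comp    : ∀ {i j k} (p : i ≤ j) (q : j ≤ k) →
                _≈_ 𝒜 (D₁ (≤-trans p q)) (_∘_ 𝒜 (D₁ q) (D₁ p))

record Cocone {o m e} {𝒜 : Category o m e} (D : DirectedDiagram 𝒜) : Set (o ⊔ m ⊔ e) where
  open DirectedDiagram D
  field
    apex    : Obj 𝒜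
    inj     : ∀ i → _⇒_ 𝒜 (D₀ i) apex
    inj-com : ∀ {i j} (p : i ≤ j) → _≈_ 𝒜 (_∘_ 𝒜 (inj j) (D₁ p)) (inj i)

IsColimit : ∀ {o m e} {𝒜 : Category o m e} {D : DirectedDiagram 𝒜} →
            Cocone D → Set (o ⊔ m ⊔ e)
IsColimit {𝒜 = 𝒜} {D} c =
  ∀ (c' : Cocone D) →
    Σ[ u ∈ _⇒_ 𝒜 (Cocone.apex c) (Cocone.apex c') ]
      ((∀ i → _≈_ 𝒜 (_∘_ 𝒜 u (Cocone.inj c i)) (Cocone.inj c' i))
      × (∀ (u' : _⇒_ 𝒜 (Cocone.apex c) (Cocone.apex c')) →
           (∀ i → _≈_ 𝒜 (_∘_ 𝒜 u' (Cocone.inj c i)) (Cocone.inj c' i)) →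
           _≈_ 𝒜 u' u))

mapDiagram : ∀ {o m e} {𝒜 : Category o m e} → Functor 𝒜 𝒜 →
             DirectedDiagram 𝒜 → DirectedDiagram 𝒜
mapDiagram {𝒜 = 𝒜} F D = record
  { Idx = Idx ; _≤_ = _≤_ ; ≤-refl = ≤-refl ; ≤-trans = ≤-trans
  ; inhabited = inhabited ; upper = upper
  ; D₀ = λ i → F₀ F (D₀ i)
  ; D₁ = λ p → F₁ F (D₁ p)
  ; D-irr = λ p q → F-resp-≈ F (D-irr p q)
  ; D-id = IsEquivalence.trans (equiv 𝒜) (F-resp-≈ F D-id) (identity F)
  ; D-comp = λ p q → IsEquivalence.trans (equiv 𝒜) (F-resp-≈ F (D-comp p q)) (homomorphism F)
  }
  where open DirectedDiagram D

mapCocone : ∀ {o m e} {𝒜 : Category o m e} (F : Functor 𝒜 𝒜) {D : DirectedDiagram 𝒜} →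
            Cocone D → Cocone (mapDiagram F D)
mapCocone {𝒜 = 𝒜} F c = record
  { apex = F₀ F (Cocone.apex c)
  ; inj = λ i → F₁ F (Cocone.inj c i)
  ; inj-com = λ p → IsEquivalence.trans (equiv 𝒜)
                      (IsEquivalence.sym (equiv 𝒜) (homomorphism F))
                      (F-resp-≈ F (Cocone.inj-com c p))
  }

Finitary : ∀ {o m e} {𝒜 : Category o m e} → Functor 𝒜 𝒜 → Set (lsuc 0ℓ ⊔ o ⊔ m ⊔ e)
Finitary {𝒜 = 𝒜} F =
  ∀ (D : DirectedDiagram 𝒜) (c : Cocone D) → IsColimit c → IsColimit (mapCocone F c)

record AlgObj {o m e} {𝒜 : Category o m e} (L : Functor 𝒜 𝒜) : Set (o ⊔ m) where
  constructor alg
  field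
    car : Obj 𝒜
    str : _⇒_ 𝒜 (F₀ L car) car

record AlgHom {o m e} {𝒜 : Category o m e} {L : Functor 𝒜 𝒜}
              (A B : AlgObj L) : Set (m ⊔ e) where
  field
    hom  : _⇒_ 𝒜 (AlgObj.car A) (AlgObj.car B)
    comm : _≈_ 𝒜 (_∘_ 𝒜 hom (AlgObj.str A)) (_∘_ 𝒜 (AlgObj.str B) (F₁ L hom))

Alg : ∀ {o m e} {𝒜 : Category o m e} → Functor 𝒜 𝒜 → Category (o ⊔ m) (m ⊔ e) e
Alg {𝒜 = 𝒜} L = record
  { Obj = AlgObj L
  ; _⇒_ = AlgHom
  ; _≈_ = λ f g → AlgHom.hom f ≈′ AlgHom.hom g
  ; id = λ {A} → record { hom = id′ ; comm = idc {A} }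
  ; _∘_ = λ {A} {B} {C} g f → record { hom = AlgHom.hom g ∘′ AlgHom.hom f ; comm = compc {A} {B} {C} g f }
  ; equiv = record { refl = Equiv.refl 𝒜 ; sym = Equiv.sym 𝒜 ; trans = Equiv.trans 𝒜 }
  ; identityˡ = identityˡ 𝒜
  ; identityʳ = identityʳ 𝒜
  ; assoc = assoc 𝒜
  ; ∘-resp-≈ = ∘-resp-≈ 𝒜
  }
  where
  open Category 𝒜 using () renaming (_≈_ to _≈′_; _∘_ to _∘′_; id to id′)
  idc : ∀ {A : AlgObj L} → id′ ∘′ AlgObj.str A ≈′ AlgObj.str A ∘′ F₁ L id′
  idc {A} = begin
      id′ ∘′ AlgObj.str A              ≈⟨ identityˡ 𝒜 ⟩
      AlgObj.str A                   ≈⟨ Equiv.sym 𝒜 (identityʳ 𝒜) ⟩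
      AlgObj.str A ∘′ id′              ≈⟨ ∘-resp-≈ 𝒜 (Equiv.refl 𝒜) (Equiv.sym 𝒜 (identity L)) ⟩
      AlgObj.str A ∘′ F₁ L id′         ∎
    where open SetoidR (hom-setoid 𝒜 _ _)
  compc : ∀ {A B C : AlgObj L} (g : AlgHom B C) (f : AlgHom A B) →
          (AlgHom.hom g ∘′ AlgHom.hom f) ∘′ AlgObj.str A ≈′
          AlgObj.str C ∘′ F₁ L (AlgHom.hom g ∘′ AlgHom.hom f)
  compc {A} {B} {C} g f = begin
      (G ∘′ Fh) ∘′ α                   ≈⟨ assoc 𝒜 ⟩
      G ∘′ (Fh ∘′ α)                   ≈⟨ ∘-resp-≈ 𝒜 (Equiv.refl 𝒜) (AlgHom.comm f) ⟩
      G ∘′ (β ∘′ F₁ L Fh)              ≈⟨ Equiv.sym 𝒜 (assoc 𝒜) ⟩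
      (G ∘′ β) ∘′ F₁ L Fh              ≈⟨ ∘-resp-≈ 𝒜 (AlgHom.comm g) (Equiv.refl 𝒜) ⟩
      (γ ∘′ F₁ L G) ∘′ F₁ L Fh         ≈⟨ assoc 𝒜 ⟩
      γ ∘′ (F₁ L G ∘′ F₁ L Fh)         ≈⟨ ∘-resp-≈ 𝒜 (Equiv.refl 𝒜) (Equiv.sym 𝒜 (homomorphism L)) ⟩
      γ ∘′ F₁ L (G ∘′ Fh)              ∎
    where
    open SetoidR (hom-setoid 𝒜 _ _)
    G = AlgHom.hom g
    Fh = AlgHom.hom f
    α = AlgObj.str A
    β = AlgObj.str B
    γ = AlgObj.str C

U-Alg : ∀ {o m e} {𝒜 : Category o m e} (L : Functor 𝒜 𝒜) → Functor (Alg L) 𝒜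
U-Alg {𝒜 = 𝒜} L = record
  { F₀ = AlgObj.car ; F₁ = AlgHom.hom
  ; identity = Equiv.refl 𝒜 ; homomorphism = Equiv.refl 𝒜 ; F-resp-≈ = λ p → p }

-- The category of setoids (the role of Set as target of forgetful functors)

Setoids : Category (lsuc 0ℓ) 0ℓ 0ℓ
Setoids = record
  { Obj = Setoid 0ℓ 0ℓ
  ; _⇒_ = Func
  ; _≈_ = λ {A} {B} f g → ∀ x → Setoid._≈_ B (Func.to f x) (Func.to g x)
  ; id = λ {A} → record { to = λ x → x ; cong = λ p → p }
  ; _∘_ = λ g f → record { to = λ x → Func.to g (Func.to f x) ; cong = λ p → Func.cong g (Func.cong f p) }
  ; equiv = λ {A} {B} → record
      { refl = λ x → Setoid.refl B
      ; sym = λ p x → Setoid.sym B (p x)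
      ; trans = λ p q x → Setoid.trans B (p x) (q x) }
  ; identityˡ = λ {A} {B} x → Setoid.refl B
  ; identityʳ = λ {A} {B} x → Setoid.refl B
  ; assoc = λ {A} {B} {C} {D} x → Setoid.refl D
  ; ∘-resp-≈ = λ {A} {B} {C} {f} {h} {g} {i} p q x →
      Setoid.trans C (p (Func.to g x)) (Func.cong h (q x))
  }

discrete : Set → Setoid 0ℓ 0ℓ
discrete A = ≡.setoid A

fromSet : ∀ {A : Set} {B : Setoid 0ℓ 0ℓ} → (A → Setoid.Carrier B) → Func (discrete A) B
fromSet {B = B} f = record { to = f ; cong = λ { ≡.refl → Setoid.refl B } }

record BoundedDistributiveLattice : Set₁ where
  field
    Carrier               : Set
    _≈_                   : Rel Carrier 0ℓ
    _∨_                   : Carrier → Carrier → Carrier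
    _∧_                   : Carrier → Carrier → Carrier
    ⊤                     : Carrier
    ⊥                     : Carrier
    isDistributiveLattice : IsDistributiveLattice _≈_ _∨_ _∧_
    ∧-identityʳ           : ∀ x → (x ∧ ⊤) ≈ x
    ∨-identityʳ           : ∀ x → (x ∨ ⊥) ≈ x

data Kind : Set where
  BA DL : Kind

ObjK : Kind → Set₁
ObjK BA = BooleanAlgebra 0ℓ 0ℓ
ObjK DL = BoundedDistributiveLattice

record BLat : Set₁ where
  field
    Carrier : Set
    _≈_     : Rel Carrier 0ℓ
    isEq    : IsEquivalence _≈_
    _∨_ _∧_ : Carrier → Carrier → Carrier
    ⊤ ⊥     : Carrier

view : ∀ {k} → ObjK k → BLat
view {BA} A = record
  { Carrier = M.Carrier ; _≈_ = M._≈_ ; isEq = M.isEquivalence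
  ; _∨_ = M._∨_ ; _∧_ = M._∧_ ; ⊤ = M.⊤ ; ⊥ = M.⊥ }
  where module M = BooleanAlgebra A
view {DL} A = record
  { Carrier = M.Carrier ; _≈_ = M._≈_
  ; isEq = IsDistributiveLattice.isEquivalence M.isDistributiveLattice
  ; _∨_ = M._∨_ ; _∧_ = M._∧_ ; ⊤ = M.⊤ ; ⊥ = M.⊥ }
  where module M = BoundedDistributiveLattice A

NegPres : ∀ k (A B : ObjK k) → (BLat.Carrier (view A) → BLat.Carrier (view B)) → Set
NegPres BA A B f = ∀ x → BooleanAlgebra._≈_ B (f (BooleanAlgebra.¬_ A x)) (BooleanAlgebra.¬_ B (f x))
NegPres DL A B f = Unit

record HomK (k : Kind) (A B : ObjK k) : Set where
  private
    module A = BLat (view A)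
    module B = BLat (view B)
  field
    fun    : A.Carrier → B.Carrier
    resp   : ∀ {x y} → x A.≈ y → fun x B.≈ fun y
    pres-∨ : ∀ x y → fun (x A.∨ y) B.≈ (fun x B.∨ fun y)
    pres-∧ : ∀ x y → fun (x A.∧ y) B.≈ (fun x B.∧ fun y)
    pres-⊤ : fun A.⊤ B.≈ B.⊤
    pres-⊥ : fun A.⊥ B.≈ B.⊥
    pres-¬ : NegPres k A B fun

module _ {k : Kind} where
  private
    module V (A : ObjK k) = BLat (view A)
    module E (A : ObjK k) = IsEquivalence (BLat.isEq (view A))

  idK : ∀ {A} → HomK k A A
  idK {A} = record
    { fun = λ x → x ; resp = λ p → p
    ; pres-∨ = λ x y → E.refl A ; pres-∧ = λ x y → E.refl A
    ; pres-⊤ = E.refl A ; pres-⊥ = E.refl A ; pres-¬ = neg k A }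
    where
    neg : ∀ k (A : ObjK k) → NegPres k A A (λ x → x)
    neg BA A x = BooleanAlgebra.refl A
    neg DL A = _

  compK : ∀ {A B C} → HomK k B C → HomK k A B → HomK k A C
  compK {A} {B} {C} g f = record
    { fun = λ x → G.fun (F.fun x)
    ; resp = λ p → G.resp (F.resp p)
    ; pres-∨ = λ x y → E.trans C (G.resp (F.pres-∨ x y)) (G.pres-∨ _ _)
    ; pres-∧ = λ x y → E.trans C (G.resp (F.pres-∧ x y)) (G.pres-∧ _ _)
    ; pres-⊤ = E.trans C (G.resp F.pres-⊤) G.pres-⊤
    ; pres-⊥ = E.trans C (G.resp F.pres-⊥) G.pres-⊥
    ; pres-¬ = neg k A B C g f
    }
    where
    module G = HomK g
    module F = HomK f
    neg : ∀ k (A B C : ObjK k) (g : HomK k B C) (f : HomK k A B) →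
          NegPres k A C (λ x → HomK.fun g (HomK.fun f x))
    neg BA A B C g f x = BooleanAlgebra.trans C (HomK.resp g (HomK.pres-¬ f x)) (HomK.pres-¬ g _)
    neg DL A B C g f = _

𝒞 : Kind → Category (lsuc 0ℓ) 0ℓ 0ℓ
𝒞 k = record
  { Obj = ObjK k
  ; _⇒_ = HomK k
  ; _≈_ = λ {A} {B} f g → ∀ x → BLat._≈_ (view B) (HomK.fun f x) (HomK.fun g x)
  ; id = idK
  ; _∘_ = compK
  ; equiv = λ {A} {B} → record
      { refl = λ x → IsEquivalence.refl (BLat.isEq (view B))
      ; sym = λ p x → IsEquivalence.sym (BLat.isEq (view B)) (p x)
      ; trans = λ p q x → IsEquivalence.trans (BLat.isEq (view B)) (p x) (q x) }
  ; identityˡ = λ {A} {B} x → IsEquivalence.refl (BLat.isEq (view B))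
  ; identityʳ = λ {A} {B} x → IsEquivalence.refl (BLat.isEq (view B))
  ; assoc = λ {A} {B} {C} {D} x → IsEquivalence.refl (BLat.isEq (view D))
  ; ∘-resp-≈ = λ {A} {B} {C} {f} {h} {g} {i} p q x →
      IsEquivalence.trans (BLat.isEq (view C)) (p (HomK.fun g x)) (HomK.resp h (q x))
  }

carrierSetoid : ∀ {k} → ObjK k → Setoid 0ℓ 0ℓ
carrierSetoid A = record
  { Carrier = BLat.Carrier (view A) ; _≈_ = BLat._≈_ (view A) ; isEquivalence = BLat.isEq (view A) }

U : ∀ k → Functor (𝒞 k) Setoids
U k = record
  { F₀ = carrierSetoid
  ; F₁ = λ h → record { to = HomK.fun h ; cong = HomK.resp h }
  ; identity = λ {A} x → IsEquivalence.refl (BLat.isEq (view A))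
  ; homomorphism = λ {A} {B} {C} x → IsEquivalence.refl (BLat.isEq (view C))
  ; F-resp-≈ = λ p → p
  }

record Setting (k : Kind) (o m e : Level) : Set (lsuc (o ⊔ m ⊔ e)) where
  field
    -- free-forgetful adjunction F ⊣ U : Set → 𝒞 (free objects over sets)
    Free    : (A : Set) → UniversalArrow (U k) (discrete A)
    -- finitary endofunctor L on 𝒞 and F_L ⊣ U_L
    L       : Functor (𝒞 k) (𝒞 k)
    L-fin   : Finitary L
    FreeL   : (A : ObjK k) → UniversalArrow (U-Alg L) A
    𝒟       : Category o m e
    T       : Functor 𝒟 𝒟
    G       : Functor (𝒞 k) (𝒟 op)
    P       : Functor (𝒟 op) (𝒞 k)
    adj     : Adjunction G P
    δ       : NatTrans (L ∘F P) (P ∘F opF T)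

record Coalg {k o m e} (S : Setting k o m e) : Set (o ⊔ m) where
  constructor coalg
  open Setting S
  field
    X : Obj 𝒟
    γ : _⇒_ 𝒟 X (F₀ T X)

module Semantics {k o m e} (S : Setting k o m e) where
  open Setting S

  𝖥 : Set → ObjK k
  𝖥 A = UniversalArrow.obj (Free A)

  FL : ObjK k → AlgObj L
  FL A = UniversalArrow.obj (FreeL A)

  Fm : Set → AlgObj L
  Fm At = FL (𝖥 At)

  Formula : Set → Set
  Formula At = BLat.Carrier (view (AlgObj.car (Fm At)))

  ⊤F : ∀ At → Formula At
  ⊤F At = BLat.⊤ (view (AlgObj.car (Fm At)))

  transpose : ∀ {A : Set} {B : AlgObj L} →
              (A → BLat.Carrier (view (AlgObj.car B))) → AlgHom (Fm A) B
  transpose {A} {B} f =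
    UniversalArrow.ext (FreeL (𝖥 A)) (UniversalArrow.ext (Free A) (fromSet f))

  P̂ : Coalg S → AlgObj L
  P̂ (coalg X γ) = alg (F₀ P X) (_∘_ (𝒞 k) (F₁ P γ) (NatTrans.η δ X))

  Valuation : Set → Coalg S → Set
  Valuation At c = At → BLat.Carrier (view (F₀ P (Coalg.X c)))

  ⟦_⟧_ : ∀ {At} {c : Coalg S} → Formula At → Valuation At c →
         BLat.Carrier (view (F₀ P (Coalg.X c)))
  ⟦_⟧_ {At} {c} φ v = HomK.fun (AlgHom.hom (transpose {At} {P̂ c} v)) φ

  Valid : ∀ {At} (c : Coalg S) → Formula At → Set
  Valid {At} c φ = ∀ (v : Valuation At c) →
    BLat._≈_ (view (F₀ P (Coalg.X c))) (⟦_⟧_ {At} {c} φ v) (BLat.⊤ (view (F₀ P (Coalg.X c))))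

  _⊨_ : ∀ {At} → Coalg S → (Formula At → Set) → Set
  _⊨_ {At} c Φ = ∀ φ → Φ φ → Valid {At} c φ

  SubsetOf : ∀ {At} → (Formula At → Set) → Set
  SubsetOf {At} Φ = Σ[ φ ∈ Formula At ] Φ φ

  e₁ e₂ : ∀ {At} (Φ : Formula At → Set) → SubsetOf Φ → Formula At
  e₁ Φ (φ , _) = φ
  e₂ {At} Φ _ = ⊤F At

  ê₁ ê₂ : ∀ {At} (Φ : Formula At → Set) → AlgHom (Fm (SubsetOf Φ)) (Fm At)
  ê₁ {At} Φ = transpose {SubsetOf Φ} {Fm At} (e₁ Φ)
  ê₂ {At} Φ = transpose {SubsetOf Φ} {Fm At} (e₂ Φ)

-- An L-algebra map f : F_L 𝖥 At → P̂(X,γ) is the same thing as a valuation,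
-- namely the interpretation ⟦-⟧_v for v = f restricted to the atoms. Since
-- ê₁ and ê₂ are determined by their values on generators, f coequalizes them
-- iff it sends every φ ∈ Φ to ⊤. Orthogonality to the coequalizer q says
-- precisely that every such f coequalizes ê₁ and ê₂.
module Submission where

open import Defs
open import Data.Product using (_,_; proj₁; proj₂)
open import Function.Bundles using (_⇔_; mk⇔; Func; Equivalence)
open import Function.Properties.Equivalence using () renaming (trans to ⇔-trans; sym to ⇔-sym)
open import Relation.Binary using (Setoid)
import Relation.Binary.Reasoning.Setoid as SetoidR

module _ {o m e} (𝒜 : Category o m e) where
  open Category 𝒜

  coequalizer-orthogonal⇔ :
    ∀ {A B Q Z} {f g : A ⇒ B} {q : B ⇒ Q} → IsCoequalizer 𝒜 f g q →
    Orthogonal 𝒜 q Z ⇔ (∀ (h : B ⇒ Z) → h ∘ f ≈ h ∘ g)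
  coequalizer-orthogonal⇔ {f = f} {g} {q} coeq =
    mk⇔ coequalizes (λ coequalizes-all h → IsCoequalizer.coeq coeq h (coequalizes-all h))
    where
    coequalizes : Orthogonal 𝒜 q _ → ∀ h → h ∘ f ≈ h ∘ g
    coequalizes orth h = begin
      h ∘ f        ≈⟨ ∘-resp-≈ (Equiv.sym k∘q≈h) Equiv.refl ⟩
      (k ∘ q) ∘ f  ≈⟨ assoc ⟩
      k ∘ (q ∘ f)  ≈⟨ ∘-resp-≈ Equiv.refl (IsCoequalizer.equality coeq) ⟩
      k ∘ (q ∘ g)  ≈⟨ Equiv.sym assoc ⟩
      (k ∘ q) ∘ g  ≈⟨ ∘-resp-≈ k∘q≈h Equiv.refl ⟩
      h ∘ g        ∎
      where
      open SetoidR (hom-setoid _ _)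
      k = proj₁ (orth h)
      k∘q≈h = proj₁ (proj₂ (orth h))

module _ {o m e} {k : Kind} (S : Setting k o m e) where
  open Setting S
  open Semantics S
  open Category (Alg L) using (_∘_; _≈_)

  Carrier : AlgObj L → Set
  Carrier B = BLat.Carrier (view (AlgObj.car B))

  CarrierEq : (B : AlgObj L) → Carrier B → Carrier B → Set
  CarrierEq B = BLat._≈_ (view (AlgObj.car B))

  infix 4 CarrierEq
  syntax CarrierEq B x y = x ≈[ B ] y

  ⊤[_] : (B : AlgObj L) → Carrier B
  ⊤[ B ] = BLat.⊤ (view (AlgObj.car B))

  private
    module ≈ (B : AlgObj L) = Setoid (carrierSetoid (AlgObj.car B))

  infixr 5 _⟨$⟩_
  _⟨$⟩_ : ∀ {A B : AlgObj L} → AlgHom A B → Carrier A → Carrier B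
  f ⟨$⟩ x = HomK.fun (AlgHom.hom f) x

  generator : ∀ {A : Set} → A → Carrier (Fm A)
  generator {A} a =
    HomK.fun (UniversalArrow.η (FreeL (𝖥 A))) (Func.to (UniversalArrow.η (Free A)) a)

  transpose-β : ∀ {A : Set} {B : AlgObj L} (w : A → Carrier B) (a : A) →
                transpose {B = B} w ⟨$⟩ generator a ≈[ B ] w a
  transpose-β {A} {B} w a = ≈.trans B
    (UniversalArrow.ext-β (FreeL (𝖥 A)) {B} (UniversalArrow.ext (Free A) w̃)
                          (Func.to (UniversalArrow.η (Free A)) a))
    (UniversalArrow.ext-β (Free A) w̃ a)
    where w̃ = fromSet {B = carrierSetoid (AlgObj.car B)} w

  transpose-unique : ∀ {A : Set} {B : AlgObj L} (w : A → Carrier B) (g : AlgHom (Fm A) B) →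
                     (∀ a → g ⟨$⟩ generator a ≈[ B ] w a) → g ≈ transpose w
  transpose-unique {A} {B} w g g≈w =
    UniversalArrow.ext-unique (FreeL (𝖥 A)) (UniversalArrow.ext (Free A) w̃) g
      (UniversalArrow.ext-unique (Free A) w̃
         (Category._∘_ (𝒞 k) (AlgHom.hom g) (UniversalArrow.η (FreeL (𝖥 A)))) g≈w)
    where w̃ = fromSet {B = carrierSetoid (AlgObj.car B)} w

  transpose-η : ∀ {A : Set} {B : AlgObj L} (g : AlgHom (Fm A) B) →
                g ≈ transpose (λ a → g ⟨$⟩ generator a)
  transpose-η {B = B} g = transpose-unique _ g (λ a → ≈.refl B)

  ≈-on-generators : ∀ {A : Set} {B : AlgObj L} (g h : AlgHom (Fm A) B) →
                    (∀ a → g ⟨$⟩ generator a ≈[ B ] h ⟨$⟩ generator a) → g ≈ h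
  ≈-on-generators {B = B} g h g≈h x =
    ≈.trans B (transpose-unique _ g g≈h x) (≈.sym B (transpose-η h x))

  ∘-transpose-≈⇔ : ∀ {A : Set} {C B : AlgObj L} (u w : A → Carrier C) (f : AlgHom C B) →
                   f ∘ transpose u ≈ f ∘ transpose w ⇔ (∀ a → f ⟨$⟩ u a ≈[ B ] f ⟨$⟩ w a)
  ∘-transpose-≈⇔ {C = C} {B} u w f =
    mk⇔ pointwise (λ eq → ≈-on-generators (f ∘ transpose u) (f ∘ transpose w) (on-generators eq))
    where
    open SetoidR (carrierSetoid (AlgObj.car B))
    resp-β : ∀ v a → f ⟨$⟩ transpose {B = C} v ⟨$⟩ generator a ≈[ B ] f ⟨$⟩ v a
    resp-β v a = HomK.resp (AlgHom.hom f) (transpose-β {B = C} v a)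
    pointwise : f ∘ transpose u ≈ f ∘ transpose w → ∀ a → f ⟨$⟩ u a ≈[ B ] f ⟨$⟩ w a
    pointwise eq a = begin
      f ⟨$⟩ u a                          ≈⟨ resp-β u a ⟨
      f ⟨$⟩ transpose u ⟨$⟩ generator a  ≈⟨ eq (generator a) ⟩
      f ⟨$⟩ transpose w ⟨$⟩ generator a  ≈⟨ resp-β w a ⟩
      f ⟨$⟩ w a                          ∎
    on-generators : (∀ a → f ⟨$⟩ u a ≈[ B ] f ⟨$⟩ w a) →
                   ∀ a → f ⟨$⟩ transpose u ⟨$⟩ generator a ≈[ B ] f ⟨$⟩ transpose w ⟨$⟩ generator a
    on-generators eq a = ≈.trans B (resp-β u a) (≈.trans B (eq a) (≈.sym B (resp-β w a)))

  Validates : ∀ {At} {B : AlgObj L} → AlgHom (Fm At) B → (Formula At → Set) → Set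
  Validates {B = B} f Φ = ∀ φ → Φ φ → f ⟨$⟩ φ ≈[ B ] ⊤[ B ]

  ⊨⇔every-morphism-validates : ∀ {At} (c : Coalg S) (Φ : Formula At → Set) →
    c ⊨ Φ ⇔ (∀ (f : AlgHom (Fm At) (P̂ c)) → Validates f Φ)
  ⊨⇔every-morphism-validates c Φ = mk⇔
    (λ valid f φ φ∈Φ → ≈.trans (P̂ c) (transpose-η f φ) (valid φ φ∈Φ _))
    (λ validated φ φ∈Φ v → validated (transpose v) φ φ∈Φ)

  coequalizes-ê⇔validates : ∀ {At} {B : AlgObj L} (Φ : Formula At → Set) (f : AlgHom (Fm At) B) →
    f ∘ ê₁ Φ ≈ f ∘ ê₂ Φ ⇔ Validates f Φ
  coequalizes-ê⇔validates {At} {B} Φ f = ⇔-trans (∘-transpose-≈⇔ (e₁ Φ) (e₂ Φ) f) (mk⇔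
    (λ eq φ φ∈Φ → ≈.trans B (eq (φ , φ∈Φ)) f⊤≈⊤)
    (λ validated s → ≈.trans B (validated (proj₁ s) (proj₂ s)) (≈.sym B f⊤≈⊤)))
    where
    f⊤≈⊤ : f ⟨$⟩ ⊤F At ≈[ B ] ⊤[ B ]
    f⊤≈⊤ = HomK.pres-⊤ (AlgHom.hom f)

  every-morphism-validates⇔every-morphism-coequalizes-ê : ∀ {At} {B : AlgObj L} (Φ : Formula At → Set) →
    (∀ (f : AlgHom (Fm At) B) → Validates f Φ) ⇔ (∀ (f : AlgHom (Fm At) B) → f ∘ ê₁ Φ ≈ f ∘ ê₂ Φ)
  every-morphism-validates⇔every-morphism-coequalizes-ê Φ = mk⇔
    (λ validated f → Equivalence.from (coequalizes-ê⇔validates Φ f) (validated f))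
    (λ coequalizes f → Equivalence.to (coequalizes-ê⇔validates Φ f) (coequalizes f))

mainTheorem2 : ∀ {o m e} (k : Kind) (S : Setting k o m e) (At : Set)
    (Φ : Semantics.Formula S At → Set)
    (Q : AlgObj (Setting.L S)) (q : AlgHom (Semantics.Fm S At) Q) →
    IsCoequalizer (Alg (Setting.L S)) (Semantics.ê₁ S Φ) (Semantics.ê₂ S Φ) q →
    ∀ (c : Coalg S) →
    (Semantics._⊨_ S c Φ) ⇔ Orthogonal (Alg (Setting.L S)) q (Semantics.P̂ S c)
mainTheorem2 k S At Φ Q q coequalizer c =
  ⇔-trans (⊨⇔every-morphism-validates S c Φ)
  (⇔-trans (every-morphism-validates⇔every-morphism-coequalizes-ê S Φ)
           (⇔-sym (coequalizer-orthogonal⇔ (Alg (Setting.L S)) coequalizer)))
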